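{- Let $D$ be a signed digraph on $[n]$ and let $s\ge 2$ be an integer. The edge set of the guessing graph $\mathrm{G}(D,s)$ is \[ E(\mathrm{G}(D,s))=\bigcup_{i\in[n]} E_i(D,s), \] where \[ E_i(D,s)=\{ xy :x,y\in[s]^n,\ \text{either } (x\le_i y\text{ and } x_i>y_i)\text{, or } (y\le_i x\text{ and } y_i>x_i)\}. \]
   Context: A signed digraph on $[n]=\{0,1,\dots,n-1\}$ is a triple $D=([n],E,\lambda)$ with $E\subseteq[n]\times[n]$ (loops allowed) and $\lambda:E\to\{ -1,0,1\}$. For $i\in[n]$ and $\alpha\in\{ -1,0,1\}$ let $N^\alpha(i)=\{j:(j,i)\in E,\ \lambda(j,i)=\alpha\}$ and $N(i)=N^{ -1}(i)\cup N^0(i)\cup N^1(i)$. For an integer $s\ge2$, $[s]=\{0,\dots,s-1\}$. For $x,y\in\mathbb{N}^n$ and $i\in[n]$, $x\le_i y$ means: $x_j=y_j$ for all $j\in N^0(i)$, $x_j\le y_j$ for all $j\in N^1(i)$, and $x_j\ge y_j$ for all $j\in N^{ -1}(i)$. $F(D,s)$ is the set of maps $f=(f_0,\dots,f_{n-1}):[s]^n\to[s]^n$ such that for each $i$: $f_i(x)$ depends only on $x_{N(i)}$, $f_i$ is non-decreasing in $x_j$ when $\lambda(j,i)=1$, and non-increasing in $x_j$ when $\lambda(j,i)=-1$ (equivalently: $x\le_i y\Rightarrow f_i(x)\le f_i(y)$). $\mathrm{Fix}(f)$ is the set of fixed points of $f$. The guessing graph $\mathrm{G}(D,s)$ is the simple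 undirected graph on vertex set $[s]^n$ in which distinct $x,y$ are adjacent iff there is no $f\in F(D,s)$ with $x,y\in\mathrm{Fix}(f)$. -}

module Defs where

open import Data.Nat using (ℕ)
open import Data.Fin using (Fin; _≤_; _<_)
open import Data.Unit using (⊤)
open import Data.Maybe using (Maybe; just; nothing)
open import Data.Product using (Σ; _×_; ∃)
open import Data.Sum using (_⊎_)
open import Relation.Nullary using (¬_)
open import Relation.Binary.PropositionalEquality using (_≡_)

data Sign : Set where
  neg zer pos : Sign

-- A signed digraph on [n] (loops allowed): D j i = just α iff (j,i) ∈ E with λ(j,i) = α,
-- and D j i = nothing iff (j,i) ∉ E.
SignedDigraph : ℕ → Set
SignedDigraph n = Fin n → Fin n → Maybe Sign

Config : ℕ → ℕ → Set
Config n s = Fin n → Fin s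

LeqAt : ∀ {n s} → SignedDigraph n → Fin n → Config n s → Config n s → Set
LeqAt {n} D i x y = (j : Fin n) → Cond (D j i) j
  where
  Cond : Maybe Sign → Fin n → Set
  Cond nothing    j = ⊤
  Cond (just zer) j = x j ≡ y j
  Cond (just pos) j = x j ≤ y j
  Cond (just neg) j = y j ≤ x j

InF : ∀ {n s} → SignedDigraph n → (Config n s → Config n s) → Set
InF {n} {s} D f = (i : Fin n) (x y : Config n s) → LeqAt D i x y → f x i ≤ f y i

IsFixed : ∀ {n s} → (Config n s → Config n s) → Config n s → Set
IsFixed {n} f x = (i : Fin n) → f x i ≡ x i

Distinct : ∀ {n s} → Config n s → Config n s → Set
Distinct {n} x y = ¬ ((i : Fin n) → x i ≡ y i)

Adjacent : ∀ {n} (D : SignedDigraph n) (s : ℕ) → Config n s → Config n s → Set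
Adjacent {n} D s x y =
  Distinct x y × ¬ (Σ (Config n s → Config n s) λ f → InF D f × IsFixed f x × IsFixed f y)

InEi : ∀ {n s} → SignedDigraph n → Fin n → Config n s → Config n s → Set
InEi D i x y = (LeqAt D i x y × y i < x i) ⊎ (LeqAt D i y x × x i < y i)

-- The relation ≤_i is a decidable preorder on [s]^n; we obtain
-- this by describing it coordinatewise via the constraint each in-edge (j,i)
-- imposes on (x_j, y_j).
--  * Obstruction: if f ∈ F(D,s) fixes x and y and x ≤_i y, then
--    x_i = f_i(x) ≤ f_i(y) = y_i.  So an E_i-edge rules out every common f,
--    and its strict coordinate inequality also makes x and y distinct.
--  * Separation: if xy lies in no E_i, we build f ∈ F(D,s) fixing both.
--    For each i with, say, x_i ≤ y_i, put f_i(z) = y_i when y ≤_i z and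
--    f_i(z) = x_i otherwise.  This threshold rule is monotone for ≤_i
--    (the up-set of y is upward closed) and fixes both coordinates, because
--    y ≤_i x would force x_i = y_i in the absence of an E_i-edge.
-- Since E_i-membership is decidable, the negative information "no common f"
-- yields an explicit i; this gives the constructive forward direction.
module Submission where

open import Defs
open import Data.Nat using (ℕ) renaming (_≤_ to _≤ℕ_)
import Data.Nat.Properties as ℕ
open import Data.Fin using (Fin; _≤_; _<_; _≟_)
open import Data.Fin.Properties
  using (≤-refl; ≤-trans; ≤-antisym; ≤-total; _≤?_; _<?_; <⇒≢; any?; all?)
open import Data.Maybe using (Maybe; just; nothing)
open import Data.Unit using (⊤; tt)
open import Data.Empty using (⊥-elim)
open import Data.Product using (Σ; ∃; _,_; _×_; proj₁; proj₂)
open import Data.Sum using (inj₁; inj₂)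
open import Relation.Nullary using (Dec; yes; no; ¬_)
open import Relation.Nullary.Decidable using (map′; _×-dec_; _⊎-dec_)
open import Relation.Binary.PropositionalEquality using (_≡_; refl; sym; trans; subst₂)
open import Function.Bundles using (_⇔_; mk⇔)

Respects : ∀ {s} → Maybe Sign → Fin s → Fin s → Set
Respects nothing    a b = ⊤
Respects (just zer) a b = a ≡ b
Respects (just pos) a b = a ≤ b
Respects (just neg) a b = b ≤ a

respects-refl : ∀ {s} (e : Maybe Sign) (a : Fin s) → Respects e a a
respects-refl nothing    a = tt
respects-refl (just zer) a = refl
respects-refl (just pos) a = ≤-refl
respects-refl (just neg) a = ≤-refl

respects-trans : ∀ {s} (e : Maybe Sign) {a b c : Fin s} →
  Respects e a b → Respects e b c → Respects e a c
respects-trans nothing    _   _   = tt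
respects-trans (just zer) a≡b b≡c = trans a≡b b≡c
respects-trans (just pos) a≤b b≤c = ≤-trans a≤b b≤c
respects-trans (just neg) b≤a c≤b = ≤-trans c≤b b≤a

respects? : ∀ {s} (e : Maybe Sign) (a b : Fin s) → Dec (Respects e a b)
respects? nothing    a b = yes tt
respects? (just zer) a b = a ≟ b
respects? (just pos) a b = a ≤? b
respects? (just neg) a b = b ≤? a

module _ {n s : ℕ} (D : SignedDigraph n) where

  Coordinatewise : Fin n → Config n s → Config n s → Set
  Coordinatewise i x y = (j : Fin n) → Respects (D j i) (x j) (y j)

  coordinatewise⇒leq : ∀ {i x y} → Coordinatewise i x y → LeqAt D i x y
  coordinatewise⇒leq {i} p j with D j i | p j
  ... | nothing  | _ = tt
  ... | just zer | c = c
  ... | just pos | c = c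
  ... | just neg | c = c

  leq⇒coordinatewise : ∀ {i x y} → LeqAt D i x y → Coordinatewise i x y
  leq⇒coordinatewise {i} p j with D j i | p j
  ... | nothing  | _ = tt
  ... | just zer | c = c
  ... | just pos | c = c
  ... | just neg | c = c

  leq-refl : ∀ i (x : Config n s) → LeqAt D i x x
  leq-refl i x = coordinatewise⇒leq λ j → respects-refl (D j i) (x j)

  leq-trans : ∀ {i} {x y z : Config n s} → LeqAt D i x y → LeqAt D i y z → LeqAt D i x z
  leq-trans {i} p q = coordinatewise⇒leq λ j →
    respects-trans (D j i) (leq⇒coordinatewise p j) (leq⇒coordinatewise q j)

  leq? : ∀ i (x y : Config n s) → Dec (LeqAt D i x y)
  leq? i x y = map′ coordinatewise⇒leq leq⇒coordinatewise
    (all? λ j → respects? (D j i) (x j) (y j))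

  inEi? : ∀ i (x y : Config n s) → Dec (InEi D i x y)
  inEi? i x y = (leq? i x y ×-dec (y i <? x i)) ⊎-dec (leq? i y x ×-dec (x i <? y i))

  fixed-monotone : ∀ {f : Config n s → Config n s} → InF D f → ∀ {x y} → IsFixed f x → IsFixed f y →
    ∀ i → LeqAt D i x y → x i ≤ y i
  fixed-monotone f∈F fx fy i x≤y = subst₂ _≤_ (fx i) (fy i) (f∈F i _ _ x≤y)

  edge-blocks : ∀ {i} {x y : Config n s} → InEi D i x y →
    ¬ Σ (Config n s → Config n s) λ f → InF D f × IsFixed f x × IsFixed f y
  edge-blocks {i} (inj₁ (x≤y , y<x)) (f , f∈F , fx , fy) =
    ℕ.<⇒≱ y<x (fixed-monotone f∈F fx fy i x≤y)
  edge-blocks {i} (inj₂ (y≤x , x<y)) (f , f∈F , fx , fy) =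
    ℕ.<⇒≱ x<y (fixed-monotone f∈F fy fx i y≤x)

  edge-distinct : ∀ {i} {x y : Config n s} → InEi D i x y → Distinct x y
  edge-distinct {i} (inj₁ (_ , y<x)) x≡y = <⇒≢ y<x (sym (x≡y i))
  edge-distinct {i} (inj₂ (_ , x<y)) x≡y = <⇒≢ x<y (x≡y i)

  Monotone : Fin n → (Config n s → Fin s) → Set
  Monotone i g = ∀ z w → LeqAt D i z w → g z ≤ g w

  threshold : Fin n → Config n s → Fin s → Fin s → Config n s → Fin s
  threshold i a lo hi z with leq? i a z
  ... | yes _ = hi
  ... | no  _ = lo

  -- Up-sets are upward closed, so the threshold rule is monotone.
  threshold-monotone : ∀ i a {lo hi} → lo ≤ hi → Monotone i (threshold i a lo hi)
  threshold-monotone i a lo≤hi z w z≤w with leq? i a z | leq? i a w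
  ... | yes _   | yes _   = ≤-refl
  ... | no  _   | yes _   = lo≤hi
  ... | no  _   | no  _   = ≤-refl
  ... | yes a≤z | no a≰w  = ⊥-elim (a≰w (leq-trans a≤z z≤w))

  threshold-above : ∀ i a lo hi z → LeqAt D i a z → threshold i a lo hi z ≡ hi
  threshold-above i a lo hi z a≤z with leq? i a z
  ... | yes _   = refl
  ... | no  a≰z = ⊥-elim (a≰z a≤z)

  threshold-outside : ∀ i a lo hi z → ¬ LeqAt D i a z → threshold i a lo hi z ≡ lo
  threshold-outside i a lo hi z a≰z with leq? i a z
  ... | yes a≤z = ⊥-elim (a≰z a≤z)
  ... | no  _   = refl

  FixingRule : Fin n → Config n s → Config n s → Set
  FixingRule i a b =
    Σ (Config n s → Fin s) λ g → Monotone i g × g a ≡ a i × g b ≡ b i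

  swap-rule : ∀ {i a b} → FixingRule i a b → FixingRule i b a
  swap-rule (g , g-mono , ga , gb) = g , g-mono , gb , ga

  fixing-rule : ∀ {i} {a b : Config n s} → a i ≤ b i →
    ¬ (LeqAt D i b a × a i < b i) → FixingRule i a b
  fixing-rule {i} {a} {b} aᵢ≤bᵢ no-edge =
    threshold i b (a i) (b i) , threshold-monotone i b aᵢ≤bᵢ , fixes-a-by (leq? i b a) ,
    threshold-above i b (a i) (b i) b (leq-refl i b)
    where
    -- If b ≤_i a, the absence of an E_i-witness forces a_i = b_i.
    fixes-a-by : Dec (LeqAt D i b a) → threshold i b (a i) (b i) a ≡ a i
    fixes-a-by (yes b≤a) = trans (threshold-above i b (a i) (b i) a b≤a)
      (≤-antisym (ℕ.≮⇒≥ λ aᵢ<bᵢ → no-edge (b≤a , aᵢ<bᵢ)) aᵢ≤bᵢ)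
    fixes-a-by (no b≰a) = threshold-outside i b (a i) (b i) a b≰a

  separation : ∀ {x y : Config n s} → (∀ i → ¬ InEi D i x y) →
    Σ (Config n s → Config n s) λ f → InF D f × IsFixed f x × IsFixed f y
  separation {x} {y} no-edge =
    (λ z i → proj₁ (rule i) z) ,
    (λ i → proj₁ (proj₂ (rule i))) ,
    (λ i → proj₁ (proj₂ (proj₂ (rule i)))) ,
    (λ i → proj₂ (proj₂ (proj₂ (rule i))))
    where
    rule : ∀ i → FixingRule i x y
    rule i with ≤-total (x i) (y i)
    ... | inj₁ xᵢ≤yᵢ = fixing-rule xᵢ≤yᵢ (λ e → no-edge i (inj₂ e))
    ... | inj₂ yᵢ≤xᵢ = swap-rule (fixing-rule yᵢ≤xᵢ (λ e → no-edge i (inj₁ e)))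

proposition1 : (n s : ℕ) → 2 ≤ℕ s → (D : SignedDigraph n) → (x y : Config n s) →
    Adjacent D s x y ⇔ ∃ (λ (i : Fin n) → InEi D i x y)
proposition1 n s _ D x y = mk⇔ adjacent⇒edge edge⇒adjacent
  where
  adjacent⇒edge : Adjacent D s x y → ∃ (λ (i : Fin n) → InEi D i x y)
  adjacent⇒edge (_ , no-common-fixer) with any? (λ i → inEi? D i x y)
  ... | yes edge    = edge
  ... | no  no-edge = ⊥-elim (no-common-fixer (separation D λ i e → no-edge (i , e)))

  edge⇒adjacent : ∃ (λ (i : Fin n) → InEi D i x y) → Adjacent D s x y
  edge⇒adjacent (_ , e) = edge-distinct D e , edge-blocks D e
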